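{- Let $\tau=(R_1,\dots,R_m)$ be a relational vocabulary with arities $a_1,\dots,a_m$, $\Sigma$ a finite alphabet, and $w$ a positive integer. If $S$ is a finite $\tau$-structure with $\mathrm{dw}_\Sigma(S)\le w$, then $\mathrm{dw}_{\{0,1\}}(S)\le w^2\cdot|\Sigma|^{\max\{1,a_1,\dots,a_m\}}$.
   Context: Fix a padding symbol $\#$ not in any alphabet considered. For an alphabet $\Gamma$, $\Gamma^{\otimes a}$ is the Cartesian power $\Gamma^a$ regarded as an alphabet. For nonempty strings $u_1,\dots,u_a$ over $\Gamma$ of lengths $n_i$, $u_1\otimes\cdots\otimes u_a$ is the string of length $\max_i n_i$ whose $j$-th symbol is the tuple of the $j$-th symbols of the $u_i$, with $\#$ in place of missing symbols; $L^{\otimes a}=\{u_1\otimes\cdots\otimes u_a:u_i\in L\}$; for a language $L$ over a tensor alphabet, $\mathcal{R}(L)=\{(u_1,\dots,u_a):u_1\otimes\cdots\otimes u_a\in L\}$. ODDs. For an alphabet $\Gamma$ and $w\ge1$, a $(\Gamma,w)$-layer is a tuple $B=(\ell,r,T,I,F,\iota,\phi)$ with $\ell,r\subseteq\{0,\dots,w-1\}$, $T\subseteq\ell\times(\Gamma\sqcup\{\#\})\times r$, $I\subseteq\ell$, $F\subseteq r$, Booleans $\iota,\phi$, $I=\emptyset$ if $\iota$ is false, $F=\emptyset$ if $\phi$ is false. A $(\Gamma,w)$-ODD of length $k$ is a sequence $B_1\cdots B_k$ of such layers with $\ell(B_{i+1})=r(B_i)$, $\iota(B_i)$ true iff $i=1$,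 $\phi(B_i)$ true iff $i=k$. A nonempty string $\sigma_1\cdots\sigma_{k'}$ over $\Gamma$, $k'\le k$, is accepted if, padding with $\#$ to length $k$ (symbols $\hat\sigma_i$), there are $(p_i,\hat\sigma_i,q_i)\in T(B_i)$ with $p_{i+1}=q_i$, $p_1\in I(B_1)$, $q_k\in F(B_k)$; $L(D)$ is the set of accepted strings. Decisional width. A $\tau$-structure is strongly $(\Sigma,w)$-decisional if there are $k\ge1$, a $(\Sigma,w)$-ODD $D_0$ of length $k$ and $(\Sigma^{\otimes a_i},w)$-ODDs $D_i$ of length $k$ ($i\in[m]$) with $L(D_i)\subseteq L(D_0)^{\otimes a_i}$ such that the structure has domain $L(D_0)$ and interprets $R_i$ as $\mathcal{R}(L(D_i))$. A finite $\tau$-structure is $(\Sigma,w)$-decisional if it is isomorphic to a strongly $(\Sigma,w)$-decisional one. The $\Sigma$-decisional width $\mathrm{dw}_\Sigma(S)$ is the minimum $w$ such that $S$ is $(\Sigma,w)$-decisional. -}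

module Defs where

open import Data.Nat using (ℕ; zero; suc; _≤_; _⊔_; _*_; _^_)
open import Data.Fin using (Fin; toℕ; inject₁; fromℕ)
open import Data.Fin.Subset using (Subset; _∈_; _⊆_; ⊥)
open import Data.Bool using (Bool; true; false)
open import Data.Maybe using (Maybe; just; nothing)
open import Data.List using (List; []; _∷_; length; applyUpTo; allFin; foldr)
import Data.List as List
open import Data.Vec using (Vec)
import Data.Vec as Vec
open import Data.Product using (Σ; Σ-syntax; ∃; ∃-syntax; _×_)
open import Relation.Binary.PropositionalEquality using (_≡_; _≢_)
open import Function.Bundles using (_⇔_)
open import Function.Definitions using (Injective)

-- A (Γ,w)-layer.  States are Fin w = {0,…,w-1}; the symbol set Γ ⊔ {#}
-- is represented as Maybe Γ (nothing = the padding symbol #).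
record Layer (Γ : Set) (w : ℕ) : Set where
  field
    ℓ r  : Subset w
    T    : Fin w → Maybe Γ → Fin w → Bool
    I F  : Subset w
    ι φ  : Bool
    T-dom   : ∀ p c q → T p c q ≡ true → (p ∈ ℓ) × (q ∈ r)
    I⊆ℓ     : I ⊆ ℓ
    F⊆r     : F ⊆ r
    I-empty : ι ≡ false → I ≡ ⊥
    F-empty : φ ≡ false → F ≡ ⊥
open Layer public

record ODD (Γ : Set) (w k : ℕ) : Set where
  field
    B      : Fin k → Layer Γ w
    chain  : ∀ (i j : Fin k) → toℕ j ≡ suc (toℕ i) → ℓ (B j) ≡ r (B i)
    ι-init : ∀ i → (ι (B i) ≡ true) ⇔ (toℕ i ≡ 0)
    φ-fin  : ∀ i → (φ (B i) ≡ true) ⇔ (suc (toℕ i) ≡ k)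
open ODD public

symAt : ∀ {A : Set} → List A → ℕ → Maybe A
symAt []       _       = nothing
symAt (x ∷ xs) zero    = just x
symAt (x ∷ xs) (suc j) = symAt xs j

-- Acceptance of a string by an ODD (with padding to length k).
-- p : Fin (suc k) → Fin w lists the states p_1 = p 0, q_i = p_{i+1} = p (suc i).
Accepts : ∀ {Γ w k} → ODD Γ w k → List Γ → Set
Accepts {Γ} {w} {k} D u =
  (u ≢ []) × (length u ≤ k) ×
  (Σ[ p ∈ (Fin (suc k) → Fin w) ]
     ((∀ (i : Fin k) → toℕ i ≡ 0 → p (inject₁ i) ∈ I (B D i)) ×
      (∀ (i : Fin k) → suc (toℕ i) ≡ k → p (Fin.suc i) ∈ F (B D i)) ×
      (∀ (i : Fin k) → T (B D i) (p (inject₁ i)) (symAt u (toℕ i)) (p (Fin.suc i)) ≡ true)))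

Tensor : Set → ℕ → Set
Tensor Σ' a = Vec (Maybe Σ') a

maxLen : ∀ {A : Set} {a} → Vec (List A) a → ℕ
maxLen us = Vec.foldr _ (λ u m → length u ⊔ m) 0 us

tensor : ∀ {A : Set} {a} → Vec (List A) a → List (Tensor A a)
tensor us = applyUpTo (λ j → Vec.map (λ u → symAt u j) us) (maxLen us)

record Structure (m : ℕ) (ar : Fin m → ℕ) : Set₁ where
  field
    n   : ℕ
    Rel : (i : Fin m) → Vec (Fin n) (ar i) → Set
open Structure public

-- S is (Σ,w)-decisional: isomorphic (via the bijection f : dom S → L(D_0))
-- to a strongly (Σ,w)-decisional structure.
Decisional : ∀ {m ar} → (Σ' : Set) → (w : ℕ) → Structure m ar → Set
Decisional {m} {ar} Σ' w S =
  Σ[ k ∈ ℕ ] (1 ≤ k) ×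
  Σ[ D₀ ∈ ODD Σ' w k ]
  Σ[ D ∈ ((i : Fin m) → ODD (Tensor Σ' (ar i)) w k) ]
  (∀ i (v : List (Tensor Σ' (ar i))) → Accepts (D i) v →
     Σ[ us ∈ Vec (List Σ') (ar i) ]
       ((∀ j → Accepts D₀ (Vec.lookup us j)) × (tensor us ≡ v))) ×
  Σ[ f ∈ (Fin (n S) → List Σ') ]
    (Injective _≡_ _≡_ f ×
     (∀ u → Accepts D₀ u ⇔ (∃[ x ] f x ≡ u)) ×
     (∀ i (x : Vec (Fin (n S)) (ar i)) → Rel S i x ⇔ Accepts (D i) (tensor (Vec.map f x))))

DwLe : ∀ {m ar} → (Σ' : Set) → Structure m ar → ℕ → Set
DwLe Σ' S w = Σ[ w' ∈ ℕ ] (1 ≤ w') × (w' ≤ w) × Decisional Σ' w' S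

maxArity : (m : ℕ) → (Fin m → ℕ) → ℕ
maxArity m ar = foldr (λ i acc → ar i ⊔ acc) 1 (allFin m)

-- Write each letter c of Fin s in unary as the block of max 1 (s − 1) bits [t < c], the padding
-- symbol # as a block of #s, and tuples componentwise. An ODD over letters (or tuples of letters)
-- is simulated on the encodings by replacing each layer with a block of layers whose states pair
-- a state of the original ODD with the state of a deterministic automaton reading the block: for
-- one letter the number of 1s read so far, which takes at most s values, hence s^a values for
-- a-tuples. The last layer of a block takes the original transition on the decoded letter.
-- Because the automaton is deterministic and accepts only codewords, the encoding is injective and
-- the new ODDs accept exactly the encodings of the words the old ones accept. This needs width only
-- w · s^(max arity).

module Submission where

open import Defs
open import Data.Nat using (ℕ; zero; suc; _≤_; _<_; _*_; _+_; _^_; _∸_; _⊔_; _⊓_; _≟_; _≤?_; _<?_; z≤n; s≤s)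
open import Data.Nat.Properties
open import Data.Nat.DivMod using (_/_; _%_; m≡m%n+[m/n]*n; m%n<n)
open import Data.Fin as Fin using (Fin; toℕ; fromℕ; fromℕ<; inject₁; inject≤; quotient; remainder; combine; funToFin; finToFun)
import Data.Fin.Properties as Finₚ
open import Data.Fin.Subset using (Subset; _∈_; ⊤; ⊥)
open import Data.Fin.Subset.Properties using (∈⊤; ⊆⊤)
open import Data.Bool using (Bool; true; false; not; _∧_; if_then_else_)
open import Data.Maybe using (Maybe; just; nothing; maybe; fromMaybe; _>>=_)
import Data.Maybe as Maybe
import Data.Maybe.Properties as Maybeₚ
import Data.Maybe.Relation.Unary.All as MaybeAll
open import Data.List using (List; []; _∷_; length; applyUpTo; _++_; concatMap; foldr)
import Data.List as List
open import Data.List.Properties using (length-applyUpTo; length-++)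
open import Data.List.Relation.Unary.All using (All; []; _∷_; universal)
open import Data.Vec as Vec using (Vec; []; _∷_; lookup; replicate)
import Data.Vec.Properties as Vecₚ
open import Data.Product using (Σ-syntax; ∃-syntax; _×_; _,_; proj₁; proj₂; uncurry)
open import Data.Product.Function.NonDependent.Propositional using (_×-↪_)
open import Data.Sum using (inj₁; inj₂; [_,_]′)
open import Data.Unit using (tt) renaming (⊤ to Unit)
open import Function using (_∘_)
open import Function.Bundles using (_↪_; _⇔_; mk↪; mk⇔; module RightInverse; module Equivalence)
open import Function.Consequences.Propositional using (strictlyInverseʳ⇒inverseʳ)
open import Function.Construct.Composition using (_↪-∘_)
open import Function.Construct.Identity using (↪-id)
open import Function.Properties.Inverse using (↔⇒↪; ↔-sym)
open import Relation.Nullary using (Dec; yes; no; does)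
open import Relation.Nullary.Decidable using (dec-true; dec-false)
open import Relation.Nullary.Negation using (contradiction)
open import Relation.Binary.PropositionalEquality

private variable
  A X Y : Set
  a k l : ℕ

dec-true⁻¹ : {P : Set} (p? : Dec P) → does p? ≡ true → P
dec-true⁻¹ (yes p) _ = p

∧-true⁻¹ : ∀ {x y} → x ∧ y ≡ true → x ≡ true × y ≡ true
∧-true⁻¹ {true} y≡true = refl , y≡true

if-true-∈ : ∀ {n b} {S : Subset n} {y} → b ≡ true → y ∈ S → y ∈ (if b then S else ⊥)
if-true-∈ refl y∈S = y∈S

if-true-∈⁻ : ∀ {n b} {S : Subset n} {y} → b ≡ true → y ∈ (if b then S else ⊥) → y ∈ S
if-true-∈⁻ refl y∈S = y∈S

if-nothing⁻¹ : ∀ {b} {m : Maybe X} {y} → (if b then m else nothing) ≡ just y → b ≡ true × m ≡ just y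
if-nothing⁻¹ {b = true} e = refl , e

map-just⁻¹ : ∀ {f : X → Y} (m : Maybe X) {y} → Maybe.map f m ≡ just y → Σ[ x ∈ X ] m ≡ just x × f x ≡ y
map-just⁻¹ (just x) refl = x , refl , refl

>>=-just⁻¹ : ∀ (m : Maybe X) {f : X → Maybe Y} {y} → (m >>= f) ≡ just y → Σ[ x ∈ X ] m ≡ just x × f x ≡ just y
>>=-just⁻¹ (just x) e = x , refl , e

lookup-ext : {u v : Vec X a} → (∀ j → lookup u j ≡ lookup v j) → u ≡ v
lookup-ext {u = u} {v} h = trans (sym (Vecₚ.tabulate∘lookup u)) (trans (Vecₚ.tabulate-cong h) (Vecₚ.tabulate∘lookup v))

symAt-ext : (xs ys : List A) → (∀ n → symAt xs n ≡ symAt ys n) → xs ≡ ys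
symAt-ext []       []       _ = refl
symAt-ext []       (_ ∷ _)  h with () ← h 0
symAt-ext (_ ∷ _)  []       h with () ← h 0
symAt-ext (x ∷ xs) (y ∷ ys) h with refl ← h 0 = cong (x ∷_) (symAt-ext xs ys (λ n → h (suc n)))

symAt-≥length : (xs : List A) {n : ℕ} → length xs ≤ n → symAt xs n ≡ nothing
symAt-≥length []       _         = refl
symAt-≥length (_ ∷ xs) (s≤s len) = symAt-≥length xs len

symAt-nothing⇒length≤ : (xs : List A) (n : ℕ) → symAt xs n ≡ nothing → length xs ≤ n
symAt-nothing⇒length≤ []       n       _ = z≤n
symAt-nothing⇒length≤ (_ ∷ xs) (suc n) e = s≤s (symAt-nothing⇒length≤ xs n e)

symAt-++ˡ : (xs ys : List A) {n : ℕ} → n < length xs → symAt (xs ++ ys) n ≡ symAt xs n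
symAt-++ˡ (_ ∷ _)  ys {zero}  _       = refl
symAt-++ˡ (_ ∷ xs) ys {suc n} (s≤s p) = symAt-++ˡ xs ys p

symAt-++ʳ : (xs ys : List A) (n : ℕ) → symAt (xs ++ ys) (length xs + n) ≡ symAt ys n
symAt-++ʳ []       ys n = refl
symAt-++ʳ (_ ∷ xs) ys n = symAt-++ʳ xs ys n

symAt-applyUpTo : (f : ℕ → A) (n : ℕ) {t : ℕ} → t < n → symAt (applyUpTo f n) t ≡ just (f t)
symAt-applyUpTo f (suc n) {zero}  _       = refl
symAt-applyUpTo f (suc n) {suc t} (s≤s p) = symAt-applyUpTo (λ x → f (suc x)) n p

symAt-applyUpTo-≥ : (f : ℕ → A) (n : ℕ) {t : ℕ} → n ≤ t → symAt (applyUpTo f n) t ≡ nothing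
symAt-applyUpTo-≥ f n n≤t = symAt-≥length (applyUpTo f n) (subst (_≤ _) (sym (length-applyUpTo f n)) n≤t)

symAt-All : {P : A → Set} {xs : List A} → All P xs → ∀ n → MaybeAll.All P (symAt xs n)
symAt-All []         n       = MaybeAll.nothing
symAt-All (px ∷ _)   zero    = MaybeAll.just px
symAt-All (_ ∷ pxs)  (suc n) = symAt-All pxs n

All-symAt : {P : A → Set} (xs : List A) → (∀ n {a} → symAt xs n ≡ just a → P a) → All P xs
All-symAt []       h = []
All-symAt (x ∷ xs) h = h 0 refl ∷ All-symAt xs (λ n → h (suc n))

fromSymbols : ℕ → (ℕ → Maybe A) → List A
fromSymbols zero    c = []
fromSymbols (suc k) c with c 0
... | just a  = a ∷ fromSymbols k (λ i → c (suc i))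
... | nothing = []

length-fromSymbols : ∀ k (c : ℕ → Maybe A) → length (fromSymbols k c) ≤ k
length-fromSymbols zero    c = z≤n
length-fromSymbols (suc k) c with c 0
... | just _  = s≤s (length-fromSymbols k (λ i → c (suc i)))
... | nothing = z≤n

symAt-fromSymbols : ∀ k (c : ℕ → Maybe A) →
  (∀ i → c i ≡ nothing → c (suc i) ≡ nothing) → (∀ i → k ≤ i → c i ≡ nothing) →
  ∀ i → symAt (fromSymbols k c) i ≡ c i
symAt-fromSymbols zero    c _    beyond i = sym (beyond i z≤n)
symAt-fromSymbols (suc k) c stop beyond i with c 0 in c₀
symAt-fromSymbols (suc k) c stop beyond zero    | just _ = sym c₀
symAt-fromSymbols (suc k) c stop beyond (suc i) | just _ =
  symAt-fromSymbols k (λ j → c (suc j)) (λ j → stop (suc j)) (λ j k≤j → beyond (suc j) (s≤s k≤j)) i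
symAt-fromSymbols (suc k) c stop beyond i | nothing = sym (padding i)
  where
  padding : ∀ j → c j ≡ nothing
  padding zero    = c₀
  padding (suc j) = stop j (padding j)

-- Strings cut into blocks

module Blocks (L' : ℕ) where

  L : ℕ
  L = suc L'

  L≤suc-block : ∀ i t → L ≤ suc i * L + t
  L≤suc-block i t = ≤-trans (m≤m+n L (i * L)) (m≤m+n _ t)

  block-injective : ∀ i i' {t t'} → t < L → t' < L → i * L + t ≡ i' * L + t' → i ≡ i' × t ≡ t'
  block-injective zero     zero     _   _    e = refl , e
  block-injective zero     (suc i') t<L _    e = contradiction t<L (≤⇒≯ (subst (L ≤_) (sym e) (L≤suc-block i' _)))
  block-injective (suc i)  zero     _   t'<L e = contradiction t'<L (≤⇒≯ (subst (L ≤_) e (L≤suc-block i _)))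
  block-injective (suc i)  (suc i') t<L t'<L e
    with i≡i' , t≡t' ← block-injective i i' t<L t'<L (+-cancelˡ-≡ L _ _ (trans (sym (+-assoc L _ _)) (trans e (+-assoc L _ _))))
    = cong suc i≡i' , t≡t'

  block-decomposition : ∀ n → n ≡ n / L * L + n % L
  block-decomposition n = trans (m≡m%n+[m/n]*n n L) (+-comm (n % L) _)

  /-block : ∀ i t → t < L → (i * L + t) / L ≡ i
  /-block i t t<L = sym (proj₁ (block-injective i ((i * L + t) / L) t<L (m%n<n (i * L + t) L) (block-decomposition (i * L + t))))

  %-block : ∀ i t → t < L → (i * L + t) % L ≡ t
  %-block i t t<L = sym (proj₂ (block-injective i ((i * L + t) / L) t<L (m%n<n (i * L + t) L) (block-decomposition (i * L + t))))

  block-start : ∀ i {t} → t < L → i * L + t ≡ 0 → i ≡ 0 × t ≡ 0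
  block-start i t<L e = block-injective i 0 t<L (s≤s z≤n) e

  suc-block-end : ∀ i → suc (i * L + L') ≡ suc i * L
  suc-block-end i = cong suc (+-comm (i * L) L')

  block-end : ∀ i {k t} → t ≤ L' → suc (i * L + t) ≡ k * L → suc i ≡ k × t ≡ L'
  block-end i {k} {t} t≤L' e with m≤n⇒m<n∨m≡n t≤L'
  ... | inj₂ refl = *-cancelʳ-≡ (suc i) k L (trans (sym (suc-block-end i)) e) , refl
  ... | inj₁ t<L'
    with () ← proj₂ (block-injective i k (s≤s t<L') (s≤s z≤n) (trans (+-suc (i * L) t) (trans e (sym (+-identityʳ _)))))

  blockwise-ext : {xs ys : List A} → (∀ i t → t < L → symAt xs (i * L + t) ≡ symAt ys (i * L + t)) → xs ≡ ys
  blockwise-ext {xs = xs} {ys} h = symAt-ext xs ys λ n →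
    subst (λ m → symAt xs m ≡ symAt ys m) (sym (block-decomposition n)) (h (n / L) (n % L) (m%n<n n L))

extendFin : ∀ {k} → (Fin (suc k) → A) → ℕ → A
extendFin {k = k} f j with j ≤? k
... | yes j≤k = f (fromℕ< (s≤s j≤k))
... | no _    = f Fin.zero

extendFin-toℕ : ∀ {k} (f : Fin (suc k) → A) (y : Fin (suc k)) → extendFin f (toℕ y) ≡ f y
extendFin-toℕ {k = k} f y with toℕ y ≤? k
... | yes y≤k = cong f (Finₚ.fromℕ<-toℕ y (s≤s y≤k))
... | no  y≰k = contradiction (≤-pred (Finₚ.toℕ<n y)) y≰k

record Run {Γ : Set} {w k : ℕ} (D : ODD Γ w k) (u : List Γ) : Set where
  field
    state   : ℕ → Fin w
    initial : ∀ i → toℕ i ≡ 0 → state 0 ∈ I (B D i)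
    final   : ∀ i → suc (toℕ i) ≡ k → state k ∈ F (B D i)
    moves   : ∀ i → T (B D i) (state (toℕ i)) (symAt u (toℕ i)) (state (suc (toℕ i))) ≡ true

module _ {Γ : Set} {w k : ℕ} {D : ODD Γ w k} {u : List Γ} where

  accepts⇒run : Accepts D u → Run D u
  accepts⇒run (_ , _ , p , ini , fin , mv) = record
    { state   = extendFin p
    ; initial = λ i i≡0 → subst (_∈ I (B D i)) (at (inject₁ i) (trans (Finₚ.toℕ-inject₁ i) i≡0)) (ini i i≡0)
    ; final   = λ i last → subst (_∈ F (B D i)) (at (Fin.suc i) last) (fin i last)
    ; moves   = λ i → subst₂ (λ a b → T (B D i) a (symAt u (toℕ i)) b ≡ true)
                        (at (inject₁ i) (Finₚ.toℕ-inject₁ i)) (at (Fin.suc i) refl) (mv i)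
    }
    where
    at : ∀ y {n} → toℕ y ≡ n → p y ≡ extendFin p n
    at y refl = sym (extendFin-toℕ p y)

  run⇒accepts : u ≢ [] → length u ≤ k → Run D u → Accepts D u
  run⇒accepts u≢[] u≤k r = u≢[] , u≤k , (λ y → state (toℕ y))
    , (λ i i≡0 → subst (λ n → state n ∈ I (B D i)) (sym (trans (Finₚ.toℕ-inject₁ i) i≡0)) (initial i i≡0))
    , (λ i last → subst (λ n → state n ∈ F (B D i)) (sym last) (final i last))
    , (λ i → subst (λ n → T (B D i) (state n) (symAt u (toℕ i)) (state (suc (toℕ i))) ≡ true)
                   (sym (Finₚ.toℕ-inject₁ i)) (moves i))
    where open Run r

mk↪ₛ : (f : X → Fin l) (g : Fin l → X) → (∀ x → g (f x) ≡ x) → X ↪ Fin l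
mk↪ₛ f g gf = mk↪ {to = f} {from = g} (strictlyInverseʳ⇒inverseʳ f gf)

×↪Fin* : X ↪ Fin l → (Fin k × X) ↪ Fin (k * l)
×↪Fin* c = ↔⇒↪ (↔-sym Finₚ.*↔×) ↪-∘ (↪-id _ ×-↪ c)

Vec↪Fin^ : Vec (Fin k) a ↪ Fin (k ^ a)
Vec↪Fin^ = mk↪ₛ (λ v → funToFin (Vec.lookup v)) (λ y → Vec.tabulate (finToFun y))
  (λ v → trans (Vecₚ.tabulate-cong (Finₚ.finToFun-funToFin (Vec.lookup v))) (Vecₚ.tabulate∘lookup v))

↪-widen : X ↪ Fin k → k ≤ l → X → X ↪ Fin l
↪-widen {k = k} c k≤l x₀ = mk↪ₛ (λ x → inject≤ (to x) k≤l) narrow narrow-widen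
  where
  open RightInverse c
  narrow : Fin _ → _
  narrow y with toℕ y <? k
  ... | yes y<k = from (fromℕ< y<k)
  ... | no  _   = x₀
  narrow-widen : ∀ x → narrow (inject≤ (to x) k≤l) ≡ x
  narrow-widen x with toℕ (inject≤ (to x) k≤l) <? k
  ... | yes y<k = trans (cong from (Finₚ.toℕ-injective (trans (Finₚ.toℕ-fromℕ< y<k) (Finₚ.toℕ-inject≤ _ k≤l))))
                        (strictlyInverseʳ x)
  ... | no  y≮k = contradiction (subst (_< k) (sym (Finₚ.toℕ-inject≤ _ k≤l)) (Finₚ.toℕ<n _)) y≮k

-- Block decoders and the expansion of ODDs

codewordAt : {A C : Set} → (A → ℕ → C) → Maybe A → ℕ → Maybe C
codewordAt codeword c t = Maybe.map (λ a → codeword a t) c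

-- A letter a is written as the block codeword a 0, …, codeword a L' and # as a block of #s.
-- Blocks are read by a deterministic automaton (step on offsets t < L', finish on offset L');
-- trace c is its run on the block of c, and decode-sound says that it accepts nothing else.
-- Valid singles out the letters whose block cannot be mistaken for padding.
record BlockDecoder (A C : Set) (L' : ℕ) : Set₁ where
  field
    State    : Set
    Valid    : A → Set
    codeword : A → ℕ → C
    start    : State
    step     : ℕ → State → Maybe C → Maybe State
    finish   : State → Maybe C → Maybe (Maybe A)
    trace    : Maybe A → ℕ → State
    trace-start  : ∀ c → trace c 0 ≡ start
    trace-step   : ∀ {c} → MaybeAll.All Valid c → ∀ t → t < L' →
                   step t (trace c t) (codewordAt codeword c t) ≡ just (trace c (suc t))
    trace-finish : ∀ {c} → MaybeAll.All Valid c → finish (trace c L') (codewordAt codeword c L') ≡ just c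
    decode-sound : ∀ (x : ℕ → Maybe C) (σ : ℕ → State) {c} → σ 0 ≡ start →
                   (∀ t → t < L' → step t (σ t) (x t) ≡ just (σ (suc t))) → finish (σ L') (x L') ≡ just c →
                   MaybeAll.All Valid c × (∀ t → t ≤ L' → x t ≡ codewordAt codeword c t)

module Encoding {A C : Set} {L' : ℕ} (R : BlockDecoder A C L') where
  open BlockDecoder R
  open Blocks L'

  block : A → List C
  block a = applyUpTo (codeword a) L

  encode : List A → List C
  encode = concatMap block

  length-encode : ∀ v → length (encode v) ≡ length v * L
  length-encode []      = refl
  length-encode (a ∷ v) = trans (length-++ (block a)) (cong₂ _+_ (length-applyUpTo (codeword a) L) (length-encode v))

  symAt-encode : ∀ v i {t} → t < L → symAt (encode v) (i * L + t) ≡ codewordAt codeword (symAt v i) t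
  symAt-encode []      i       t<L = refl
  symAt-encode (a ∷ v) zero {t} t<L =
    trans (symAt-++ˡ (block a) (encode v) (subst (t <_) (sym (length-applyUpTo (codeword a) L)) t<L))
          (symAt-applyUpTo (codeword a) L t<L)
  symAt-encode (a ∷ v) (suc i) {t} t<L = begin
    symAt (block a ++ encode v) (L + i * L + t)
      ≡⟨ cong (symAt (block a ++ encode v)) (+-assoc L (i * L) t) ⟩
    symAt (block a ++ encode v) (L + (i * L + t))
      ≡⟨ cong (λ n → symAt (block a ++ encode v) (n + (i * L + t))) (sym (length-applyUpTo (codeword a) L)) ⟩
    symAt (block a ++ encode v) (length (block a) + (i * L + t))
      ≡⟨ symAt-++ʳ (block a) (encode v) (i * L + t) ⟩
    symAt (encode v) (i * L + t)
      ≡⟨ symAt-encode v i t<L ⟩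
    codewordAt codeword (symAt v i) t ∎
    where open ≡-Reasoning

  codewordAt-nothing⁻¹ : ∀ c {t} → codewordAt codeword c t ≡ nothing → c ≡ nothing
  codewordAt-nothing⁻¹ nothing _ = refl

  encode≢[] : ∀ {v} → v ≢ [] → encode v ≢ []
  encode≢[] {[]}    v≢[] = contradiction refl v≢[]
  encode≢[] {_ ∷ _} _    ()

  codewordAt-injective : ∀ {c c'} → MaybeAll.All Valid c → MaybeAll.All Valid c' →
    (∀ t → t ≤ L' → codewordAt codeword c t ≡ codewordAt codeword c' t) → c ≡ c'
  codewordAt-injective {c} {c'} valid valid' same = Maybeₚ.just-injective (begin
    just c                                                 ≡⟨ trace-finish valid ⟨
    finish (trace c L') (codewordAt codeword c L')         ≡⟨ cong₂ finish (same-trace L' ≤-refl) (same L' ≤-refl) ⟩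
    finish (trace c' L') (codewordAt codeword c' L')       ≡⟨ trace-finish valid' ⟩
    just c'                                                ∎)
    where
    open ≡-Reasoning
    same-trace : ∀ t → t ≤ L' → trace c t ≡ trace c' t
    same-trace zero    _    = trans (trace-start c) (sym (trace-start c'))
    same-trace (suc t) t<L' = Maybeₚ.just-injective (begin
      just (trace c (suc t))                              ≡⟨ trace-step valid t t<L' ⟨
      step t (trace c t) (codewordAt codeword c t)        ≡⟨ cong₂ (step t) (same-trace t (<⇒≤ t<L')) (same t (<⇒≤ t<L')) ⟩
      step t (trace c' t) (codewordAt codeword c' t)      ≡⟨ trace-step valid' t t<L' ⟩
      just (trace c' (suc t))                             ∎)

  encode-injective : ∀ {v v'} → All Valid v → All Valid v' → encode v ≡ encode v' → v ≡ v'
  encode-injective {v} {v'} valid valid' e = symAt-ext v v' λ i →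
    codewordAt-injective (symAt-All valid i) (symAt-All valid' i) λ t t≤L' → begin
      codewordAt codeword (symAt v i) t    ≡⟨ symAt-encode v i (s≤s t≤L') ⟨
      symAt (encode v) (i * L + t)         ≡⟨ cong (λ u → symAt u (i * L + t)) e ⟩
      symAt (encode v') (i * L + t)        ≡⟨ symAt-encode v' i (s≤s t≤L') ⟩
      codewordAt codeword (symAt v' i) t   ∎
    where open ≡-Reasoning

module Expansion {A C : Set} {L' : ℕ} (R : BlockDecoder A C L') {N : ℕ} (code : BlockDecoder.State R ↪ Fin N)
                 {w k : ℕ} (D : ODD A w k) where
  open BlockDecoder R
  open Encoding R
  open Blocks L'
  private
    pairing = ×↪Fin* {k = w} code
    module pairing = RightInverse pairing

  W : ℕ
  W = w * N

  pair : Fin w → State → Fin W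
  pair p σ = pairing.to (p , σ)

  outer : Fin W → Fin w
  outer y = proj₁ (pairing.from y)

  inner : Fin W → State
  inner y = proj₂ (pairing.from y)

  outer-pair : ∀ p σ → outer (pair p σ) ≡ p
  outer-pair p σ = cong proj₁ (pairing.strictlyInverseʳ (p , σ))

  inner-pair : ∀ p σ → inner (pair p σ) ≡ σ
  inner-pair p σ = cong proj₂ (pairing.strictlyInverseʳ (p , σ))

  -- The first layer of a block ignores the incoming decoder state, a leftover of the previous block.
  resume : ℕ → State → State
  resume zero    _ = start
  resume (suc _) σ = σ

  innerMove : ℕ → Fin W → Maybe C → Fin W → Bool
  innerMove t y x z = does (Maybeₚ.≡-dec Finₚ._≟_ (Maybe.map (pair (outer y)) (step t (resume t (inner y)) x)) (just z))

  lastMove : Fin k → Fin W → Maybe C → Fin W → Bool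
  lastMove i y x z = maybe (λ c → T (B D i) (outer y) c (outer z)) false (finish (resume L' (inner y)) x)

  move : Fin k → ℕ → Fin W → Maybe C → Fin W → Bool
  move i t = if does (t ≟ L') then lastMove i else innerMove t

  move-inner : ∀ i {t} → t < L' → ∀ {y x z} → move i t y x z ≡ innerMove t y x z
  move-inner i {t} t<L' {y} {x} {z} = cong (λ b → (if b then lastMove i else innerMove t) y x z) (dec-false (t ≟ L') (<⇒≢ t<L'))

  move-last : ∀ i {y x z} → move i L' y x z ≡ lastMove i y x z
  move-last i {y} {x} {z} = cong (λ b → (if b then lastMove i else innerMove L') y x z) (dec-true (L' ≟ L') refl)

  innerMove-intro : ∀ {t p σ x σ'} → step t (resume t σ) x ≡ just σ' → innerMove t (pair p σ) x (pair p σ') ≡ true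
  innerMove-intro {t} {p} {σ} {x} {σ'} e = dec-true (Maybeₚ.≡-dec Finₚ._≟_ _ _) (begin
    Maybe.map (pair (outer (pair p σ))) (step t (resume t (inner (pair p σ))) x)
      ≡⟨ cong₂ (λ q τ → Maybe.map (pair q) (step t (resume t τ) x)) (outer-pair p σ) (inner-pair p σ) ⟩
    Maybe.map (pair p) (step t (resume t σ) x)
      ≡⟨ cong (Maybe.map (pair p)) e ⟩
    just (pair p σ') ∎)
    where open ≡-Reasoning

  innerMove-elim : ∀ {t y x z} → innerMove t y x z ≡ true →
                   outer z ≡ outer y × step t (resume t (inner y)) x ≡ just (inner z)
  innerMove-elim {t} {y} {x} {z} e = pair⁻¹ _ (dec-true⁻¹ (Maybeₚ.≡-dec Finₚ._≟_ _ _) e)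
    where
    pair⁻¹ : ∀ m → Maybe.map (pair (outer y)) m ≡ just z → outer z ≡ outer y × m ≡ just (inner z)
    pair⁻¹ (just σ) refl = outer-pair (outer y) σ , cong just (sym (inner-pair (outer y) σ))

  lastMove-intro : ∀ i {p σ x c z} → finish (resume L' σ) x ≡ just c → T (B D i) p c (outer z) ≡ true →
                   lastMove i (pair p σ) x z ≡ true
  lastMove-intro i {p} {σ} e tr rewrite inner-pair p σ | outer-pair p σ | e = tr

  lastMove-elim : ∀ i {y x z} → lastMove i y x z ≡ true →
    Σ[ c ∈ Maybe A ] finish (resume L' (inner y)) x ≡ just c × T (B D i) (outer y) c (outer z) ≡ true
  lastMove-elim i {y} {x} e with finish (resume L' (inner y)) x
  ... | just c = c , refl , e

  preimage : Subset w → Subset W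
  preimage S = Vec.tabulate (λ y → Vec.lookup S (outer y))

  ∈-preimage : ∀ {S y} → outer y ∈ S → y ∈ preimage S
  ∈-preimage {S} {y} o∈S = Vecₚ.lookup⇒[]= y _ (trans (Vecₚ.lookup∘tabulate _ y) (Vecₚ.[]=⇒lookup o∈S))

  ∈-preimage⁻ : ∀ {S y} → y ∈ preimage S → outer y ∈ S
  ∈-preimage⁻ {S} {y} y∈ = Vecₚ.lookup⇒[]= (outer y) S (trans (sym (Vecₚ.lookup∘tabulate _ y)) (Vecₚ.[]=⇒lookup y∈))

  isFirst : Fin k → Fin L → Bool
  isFirst i t = ι (B D i) ∧ does (toℕ t ≟ 0)

  isLast : Fin k → Fin L → Bool
  isLast i t = φ (B D i) ∧ does (toℕ t ≟ L')

  layer : Fin k → Fin L → Layer C W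
  layer i t = record
    { ℓ = ⊤ ; r = ⊤
    ; T = move i (toℕ t)
    ; I = if isFirst i t then preimage (I (B D i)) else ⊥
    ; F = if isLast i t then preimage (F (B D i)) else ⊥
    ; ι = isFirst i t ; φ = isLast i t
    ; T-dom = λ _ _ _ _ → ∈⊤ , ∈⊤
    ; I⊆ℓ = ⊆⊤ ; F⊆r = ⊆⊤
    ; I-empty = cong (λ b → if b then preimage (I (B D i)) else ⊥)
    ; F-empty = cong (λ b → if b then preimage (F (B D i)) else ⊥)
    }

  blockOf : Fin (k * L) → Fin k
  blockOf = quotient L

  offsetOf : Fin (k * L) → Fin L
  offsetOf = remainder {k} L

  toℕ-combine : ∀ (i : Fin k) (t : Fin L) → toℕ (combine i t) ≡ toℕ i * L + toℕ t
  toℕ-combine i t = trans (Finₚ.toℕ-combine i t) (cong (_+ toℕ t) (*-comm L (toℕ i)))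

  toℕ-blockOf-offsetOf : ∀ i' → toℕ i' ≡ toℕ (blockOf i') * L + toℕ (offsetOf i')
  toℕ-blockOf-offsetOf i' = trans (cong toℕ (sym (Finₚ.combine-remQuot {k} L i'))) (toℕ-combine (blockOf i') (offsetOf i'))

  first-position : ∀ i' → toℕ i' ≡ 0 → toℕ (blockOf i') ≡ 0 × toℕ (offsetOf i') ≡ 0
  first-position i' e =
    block-start (toℕ (blockOf i')) (Finₚ.toℕ<n (offsetOf i')) (trans (sym (toℕ-blockOf-offsetOf i')) e)

  last-position : ∀ i' → suc (toℕ i') ≡ k * L → suc (toℕ (blockOf i')) ≡ k × toℕ (offsetOf i') ≡ L'
  last-position i' e =
    block-end (toℕ (blockOf i')) (≤-pred (Finₚ.toℕ<n (offsetOf i'))) (trans (cong suc (sym (toℕ-blockOf-offsetOf i'))) e)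

  isFirst⇔ : ∀ i' → (isFirst (blockOf i') (offsetOf i') ≡ true) ⇔ (toℕ i' ≡ 0)
  isFirst⇔ i' = mk⇔ to from
    where
    i = blockOf i' ; t = offsetOf i'
    to : isFirst i t ≡ true → toℕ i' ≡ 0
    to e with ι≡true , t≡0 ← ∧-true⁻¹ e =
      trans (toℕ-blockOf-offsetOf i')
            (cong₂ (λ a b → a * L + b) (Equivalence.to (ι-init D i) ι≡true) (dec-true⁻¹ (toℕ t ≟ 0) t≡0))
    from : toℕ i' ≡ 0 → isFirst i t ≡ true
    from e with i≡0 , t≡0 ← first-position i' e =
      cong₂ _∧_ (Equivalence.from (ι-init D i) i≡0) (dec-true (toℕ t ≟ 0) t≡0)

  isLast⇔ : ∀ i' → (isLast (blockOf i') (offsetOf i') ≡ true) ⇔ (suc (toℕ i') ≡ k * L)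
  isLast⇔ i' = mk⇔ to from
    where
    i = blockOf i' ; t = offsetOf i'
    to : isLast i t ≡ true → suc (toℕ i') ≡ k * L
    to e with φ≡true , t≡L' ← ∧-true⁻¹ e = begin
      suc (toℕ i')                ≡⟨ cong suc (toℕ-blockOf-offsetOf i') ⟩
      suc (toℕ i * L + toℕ t)     ≡⟨ cong (λ n → suc (toℕ i * L + n)) (dec-true⁻¹ (toℕ t ≟ L') t≡L') ⟩
      suc (toℕ i * L + L')        ≡⟨ suc-block-end (toℕ i) ⟩
      suc (toℕ i) * L             ≡⟨ cong (_* L) (Equivalence.to (φ-fin D i) φ≡true) ⟩
      k * L                       ∎
      where open ≡-Reasoning
    from : suc (toℕ i') ≡ k * L → isLast i t ≡ true
    from e with last , t≡L' ← last-position i' e =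
      cong₂ _∧_ (Equivalence.from (φ-fin D i) last) (dec-true (toℕ t ≟ L') t≡L')

  expanded : ODD C W (k * L)
  expanded = record
    { B      = λ i' → layer (blockOf i') (offsetOf i')
    ; chain  = λ _ _ _ → refl
    ; ι-init = isFirst⇔
    ; φ-fin  = isLast⇔
    }

  layer-combine : ∀ i t → B expanded (combine i t) ≡ layer i t
  layer-combine i t = cong (uncurry layer) (Finₚ.remQuot-combine i t)

  resume-trace : ∀ c t → resume t (trace c t) ≡ trace c t
  resume-trace c zero    = sym (trace-start c)
  resume-trace c (suc t) = refl

  module Complete {v : List A} (valid : All Valid v) (run : Run D v) where
    open Run run using (state; initial; final; moves)

    expandedState : ℕ → Fin W
    expandedState n = pair (state (n / L)) (trace (symAt v (n / L)) (n % L))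

    expandedState-block : ∀ i {t} → t < L → expandedState (i * L + t) ≡ pair (state i) (trace (symAt v i) t)
    expandedState-block i {t} t<L = cong₂ (λ q r → pair (state q) (trace (symAt v q) r)) (/-block i t t<L) (%-block i t t<L)

    outer-expandedState : ∀ i → outer (expandedState (i * L)) ≡ state i
    outer-expandedState i = trans (cong (λ n → outer (expandedState n)) (sym (+-identityʳ (i * L))))
                                  (trans (cong outer (expandedState-block i (s≤s z≤n))) (outer-pair _ _))

    block-move : ∀ (i : Fin k) t → t < L →
      move i t (expandedState (toℕ i * L + t)) (symAt (encode v) (toℕ i * L + t)) (expandedState (suc (toℕ i * L + t))) ≡ true
    block-move i t t<L with m≤n⇒m<n∨m≡n (≤-pred t<L)
    ... | inj₁ t<L' = begin
      move i t (expandedState m) x (expandedState (suc m))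
        ≡⟨ move-inner i t<L' ⟩
      innerMove t (expandedState m) x (expandedState (suc m))
        ≡⟨ cong₂ (λ y z → innerMove t y x z) (expandedState-block (toℕ i) t<L) next ⟩
      innerMove t (pair p (trace c t)) x (pair p (trace c (suc t)))
        ≡⟨ innerMove-intro (trans (cong₂ (step t) (resume-trace c t) (symAt-encode v (toℕ i) t<L))
                                  (trace-step (symAt-All valid (toℕ i)) t t<L')) ⟩
      true ∎
      where
        open ≡-Reasoning
        m = toℕ i * L + t
        x = symAt (encode v) m
        c = symAt v (toℕ i)
        p = state (toℕ i)
        next : expandedState (suc m) ≡ pair p (trace c (suc t))
        next = trans (cong expandedState (sym (+-suc (toℕ i * L) t))) (expandedState-block (toℕ i) (s≤s t<L'))
    ... | inj₂ refl = begin
      move i L' (expandedState m) x (expandedState (suc m))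
        ≡⟨ move-last i ⟩
      lastMove i (expandedState m) x (expandedState (suc m))
        ≡⟨ cong (λ y → lastMove i y x (expandedState (suc m))) (expandedState-block (toℕ i) t<L) ⟩
      lastMove i (pair p (trace c L')) x (expandedState (suc m))
        ≡⟨ lastMove-intro i (trans (cong₂ finish (resume-trace c L') (symAt-encode v (toℕ i) t<L))
                                   (trace-finish (symAt-All valid (toℕ i))))
                            (subst (λ q → T (B D i) p c q ≡ true) (sym next) (moves i)) ⟩
      true ∎
      where
        open ≡-Reasoning
        m = toℕ i * L + L'
        x = symAt (encode v) m
        c = symAt v (toℕ i)
        p = state (toℕ i)
        next : outer (expandedState (suc m)) ≡ state (suc (toℕ i))
        next = trans (cong (outer ∘ expandedState) (suc-block-end (toℕ i))) (outer-expandedState (suc (toℕ i)))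

    expanded-run : Run expanded (encode v)
    expanded-run = record
      { state   = expandedState
      ; initial = λ i' i'≡0 → if-true-∈ (Equivalence.from (isFirst⇔ i') i'≡0) (∈-preimage
          (subst (_∈ I (B D (blockOf i'))) (sym (outer-expandedState 0))
                 (initial (blockOf i') (proj₁ (first-position i' i'≡0)))))
      ; final   = λ i' last → if-true-∈ (Equivalence.from (isLast⇔ i') last) (∈-preimage
          (subst (_∈ F (B D (blockOf i'))) (sym (outer-expandedState k))
                 (final (blockOf i') (proj₁ (last-position i' last)))))
      ; moves   = λ i' →
          subst (λ n → move (blockOf i') (toℕ (offsetOf i')) (expandedState n) (symAt (encode v) n) (expandedState (suc n)) ≡ true)
                (sym (toℕ-blockOf-offsetOf i')) (block-move (blockOf i') (toℕ (offsetOf i')) (Finₚ.toℕ<n (offsetOf i')))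
      }

  expand-complete : ∀ {v} → All Valid v → Accepts D v → Accepts expanded (encode v)
  expand-complete {v} valid acc@(v≢[] , v≤k , _) =
    run⇒accepts (encode≢[] v≢[]) (subst (_≤ k * L) (sym (length-encode v)) (*-monoˡ-≤ L v≤k))
                (Complete.expanded-run valid (accepts⇒run acc))

  module Sound {u : List C} (u≤kL : length u ≤ k * L) (run : Run expanded u) where
    open Run run using (state; initial; final; moves)

    pos : Fin k → ℕ → ℕ
    pos i t = toℕ i * L + t

    block-move : ∀ i {t} → t < L → move i t (state (pos i t)) (symAt u (pos i t)) (state (suc (pos i t))) ≡ true
    block-move i {t} t<L =
      subst (λ r → move i r (state (pos i r)) (symAt u (pos i r)) (state (suc (pos i r))) ≡ true) (Finₚ.toℕ-fromℕ< t<L)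
        (subst (λ m → move i (toℕ t') (state m) (symAt u m) (state (suc m)) ≡ true) (toℕ-combine i t')
          (subst (λ Λ → T Λ (state (toℕ i')) (symAt u (toℕ i')) (state (suc (toℕ i'))) ≡ true)
                 (layer-combine i t') (moves i')))
      where
        t' = fromℕ< t<L
        i' = combine i t'

    inner-step : ∀ i {t} → t < L' →
      outer (state (pos i (suc t))) ≡ outer (state (pos i t)) ×
      step t (resume t (inner (state (pos i t)))) (symAt u (pos i t)) ≡ just (inner (state (pos i (suc t))))
    inner-step i {t} t<L' =
      subst (λ m → outer (state m) ≡ outer (state (pos i t)) ×
                   step t (resume t (inner (state (pos i t)))) (symAt u (pos i t)) ≡ just (inner (state m)))
        (sym (+-suc (toℕ i * L) t))
        (innerMove-elim (trans (sym (move-inner i t<L')) (block-move i (s≤s (<⇒≤ t<L')))))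

    outer-block : ∀ i t → t ≤ L' → outer (state (pos i t)) ≡ outer (state (pos i 0))
    outer-block i zero    _    = refl
    outer-block i (suc t) t<L' = trans (proj₁ (inner-step i t<L')) (outer-block i t (<⇒≤ t<L'))

    last-step : ∀ i → Σ[ c ∈ Maybe A ] finish (resume L' (inner (state (pos i L')))) (symAt u (pos i L')) ≡ just c ×
                                       T (B D i) (outer (state (pos i L'))) c (outer (state (suc (pos i L')))) ≡ true
    last-step i = lastMove-elim i (trans (sym (move-last i)) (block-move i ≤-refl))

    blockLetter : Fin k → Maybe A
    blockLetter i = proj₁ (last-step i)

    blockLetter-sound : ∀ i → MaybeAll.All Valid (blockLetter i) ×
                              (∀ t → t ≤ L' → symAt u (pos i t) ≡ codewordAt codeword (blockLetter i) t)
    blockLetter-sound i = decode-sound (λ t → symAt u (pos i t)) (λ t → resume t (inner (state (pos i t)))) refl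
                            (λ t t<L' → proj₂ (inner-step i t<L')) (proj₁ (proj₂ (last-step i)))

    letters : ℕ → Maybe A
    letters j with j <? k
    ... | yes j<k = blockLetter (fromℕ< j<k)
    ... | no  _   = nothing

    letters-toℕ : ∀ i → letters (toℕ i) ≡ blockLetter i
    letters-toℕ i with toℕ i <? k
    ... | yes i<k = cong blockLetter (Finₚ.fromℕ<-toℕ i i<k)
    ... | no  i≮k = contradiction (Finₚ.toℕ<n i) i≮k

    letters-beyond : ∀ j → k ≤ j → letters j ≡ nothing
    letters-beyond j k≤j with j <? k
    ... | yes j<k = contradiction k≤j (<⇒≱ j<k)
    ... | no  _   = refl

    letters-valid : ∀ j → MaybeAll.All Valid (letters j)
    letters-valid j with j <? k
    ... | yes j<k = proj₁ (blockLetter-sound (fromℕ< j<k))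
    ... | no  _   = MaybeAll.nothing

    letters-codeword : ∀ j t → t ≤ L' → symAt u (j * L + t) ≡ codewordAt codeword (letters j) t
    letters-codeword j t t≤L' with j <? k
    ... | yes j<k = subst (λ i → symAt u (i * L + t) ≡ codewordAt codeword (blockLetter (fromℕ< j<k)) t)
                          (Finₚ.toℕ-fromℕ< j<k) (proj₂ (blockLetter-sound (fromℕ< j<k)) t t≤L')
    ... | no  j≮k = symAt-≥length u (≤-trans u≤kL (≤-trans (*-monoˡ-≤ L (≮⇒≥ j≮k)) (m≤m+n (j * L) t)))

    letters-stop : ∀ j → letters j ≡ nothing → letters (suc j) ≡ nothing
    letters-stop j none =
      codewordAt-nothing⁻¹ (letters (suc j)) (trans (sym (letters-codeword (suc j) 0 z≤n)) (symAt-≥length u ends))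
      where
        ends : length u ≤ suc j * L + 0
        ends = ≤-trans (symAt-nothing⇒length≤ u (j * L + 0) (trans (letters-codeword j 0 z≤n) (cong (λ c → codewordAt codeword c 0) none)))
                       (+-monoˡ-≤ 0 (*-monoˡ-≤ L (n≤1+n j)))

    decoded : List A
    decoded = fromSymbols k letters

    symAt-decoded : ∀ j → symAt decoded j ≡ letters j
    symAt-decoded = symAt-fromSymbols k letters letters-stop letters-beyond

    u≡encode-decoded : u ≡ encode decoded
    u≡encode-decoded = blockwise-ext λ j t t<L → begin
      symAt u (j * L + t)                         ≡⟨ letters-codeword j t (≤-pred t<L) ⟩
      codewordAt codeword (letters j) t           ≡⟨ cong (λ c → codewordAt codeword c t) (symAt-decoded j) ⟨
      codewordAt codeword (symAt decoded j) t     ≡⟨ symAt-encode decoded j t<L ⟨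
      symAt (encode decoded) (j * L + t)          ∎
      where open ≡-Reasoning

    decoded-valid : All Valid decoded
    decoded-valid = All-symAt decoded λ j e →
      just-valid (subst (MaybeAll.All Valid) (trans (sym (symAt-decoded j)) e) (letters-valid j))
      where
        just-valid : ∀ {a} → MaybeAll.All Valid (just a) → Valid a
        just-valid (MaybeAll.just va) = va

    boundary : ℕ → Fin w
    boundary j = outer (state (j * L))

    boundary-move : ∀ i → T (B D i) (boundary (toℕ i)) (symAt decoded (toℕ i)) (boundary (suc (toℕ i))) ≡ true
    boundary-move i =
      subst (λ a → T (B D i) (boundary (toℕ i)) a (boundary (suc (toℕ i))) ≡ true)
            (sym (trans (symAt-decoded (toℕ i)) (letters-toℕ i)))
        (subst₂ (λ p q → T (B D i) p (blockLetter i) q ≡ true)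
          (trans (outer-block i L' ≤-refl) (cong (λ m → outer (state m)) (+-identityʳ _)))
          (cong (λ m → outer (state m)) (suc-block-end (toℕ i)))
          (proj₂ (proj₂ (last-step i))))

    decoded-run : Run D decoded
    decoded-run = record
      { state   = boundary
      ; initial = λ i i≡0 → ∈-preimage⁻ (if-true-∈⁻ (cong₂ _∧_ (Equivalence.from (ι-init D i) i≡0) refl)
          (subst (λ Λ → state 0 ∈ I Λ) (layer-combine i Fin.zero)
            (initial (combine i Fin.zero) (trans (toℕ-combine i Fin.zero) (trans (+-identityʳ _) (cong (_* L) i≡0))))))
      ; final   = λ i last → ∈-preimage⁻ (if-true-∈⁻
          (cong₂ _∧_ (Equivalence.from (φ-fin D i) last) (dec-true (toℕ (fromℕ L') ≟ L') (Finₚ.toℕ-fromℕ L')))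
          (subst (λ Λ → state (k * L) ∈ F Λ) (layer-combine i (fromℕ L'))
            (final (combine i (fromℕ L')) (begin
              suc (toℕ (combine i (fromℕ L')))
                ≡⟨ cong suc (trans (toℕ-combine i (fromℕ L')) (cong (toℕ i * L +_) (Finₚ.toℕ-fromℕ L'))) ⟩
              suc (toℕ i * L + L')                ≡⟨ suc-block-end (toℕ i) ⟩
              suc (toℕ i) * L                     ≡⟨ cong (_* L) last ⟩
              k * L                               ∎))))
      ; moves   = boundary-move
      }
      where open ≡-Reasoning

  expand-sound : ∀ {u} → Accepts expanded u → Σ[ v ∈ List A ] u ≡ encode v × All Valid v × Accepts D v
  expand-sound {u} acc@(u≢[] , u≤kL , _) =
    decoded , u≡encode-decoded , decoded-valid ,
    run⇒accepts (λ v≡[] → u≢[] (trans u≡encode-decoded (cong encode v≡[]))) (length-fromSymbols k letters) decoded-run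
    where open Sound u≤kL (accepts⇒run acc)

  expand-reflects : ∀ {v} → All Valid v → Accepts expanded (encode v) → Accepts D v
  expand-reflects valid acc with v' , e , valid' , acc' ← expand-sound acc =
    subst (Accepts D) (sym (encode-injective valid valid' e)) acc'

-- The unary code of Fin (suc s'): the letter a becomes the bits [t < a] for t ≤ L', so blocks
-- have length max 1 s'.
module Thermometer (s' : ℕ) where

  L' : ℕ
  L' = s' ∸ 1

  Letter : Set
  Letter = Fin (suc s')

  data Phase : Set where
    padding : Phase
    counted : ℕ → Phase

  -- The decoder state is the number of 1s read so far. Before offset t ≥ 1 of a block at most
  -- L' < s' of them have been read, so there the value s' is free to mark a block of #s.
  hash : Letter
  hash = fromℕ s'

  phase : ℕ → Letter → Phase
  phase zero    σ = counted (toℕ σ)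
  phase (suc t) σ = if does (toℕ σ ≟ s') then padding else counted (toℕ σ)

  advance : ℕ → Phase → Maybe Bool → Maybe Phase
  advance t       padding     nothing      = just padding
  advance t       padding     (just _)     = nothing
  advance t       (counted c) (just true)  = if does (c ≟ t) then just (counted (suc t)) else nothing
  advance t       (counted c) (just false) = just (counted c)
  advance zero    (counted _) nothing      = just padding
  advance (suc _) (counted _) nothing      = nothing

  toFin : ℕ → Maybe Letter
  toFin c with c <? suc s'
  ... | yes c<s = just (fromℕ< c<s)
  ... | no  _   = nothing

  toFin-toℕ : ∀ {c} (a : Letter) → toℕ a ≡ c → toFin c ≡ just a
  toFin-toℕ {c} a refl with c <? suc s'
  ... | yes c<s = cong just (Finₚ.fromℕ<-toℕ a c<s)
  ... | no  c≮s = contradiction (Finₚ.toℕ<n a) c≮s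

  toFin⁻¹ : ∀ c {a} → toFin c ≡ just a → toℕ a ≡ c
  toFin⁻¹ c e with c <? suc s'
  toFin⁻¹ c refl | yes c<s = Finₚ.toℕ-fromℕ< c<s

  toState : Phase → Maybe Letter
  toState padding     = just hash
  toState (counted c) = toFin c

  toLetter : Phase → Maybe (Maybe Letter)
  toLetter padding     = just nothing
  toLetter (counted c) = Maybe.map just (toFin c)

  bit : Letter → ℕ → Bool
  bit a t = does (t <? toℕ a)

  trace : Maybe Letter → ℕ → Letter
  trace nothing  zero    = Fin.zero
  trace nothing  (suc _) = hash
  trace (just a) t       = fromℕ< (≤-<-trans (m⊓n≤n t (toℕ a)) (Finₚ.toℕ<n a))

  tracePhase : Maybe Letter → ℕ → Phase
  tracePhase nothing  zero    = counted 0
  tracePhase nothing  (suc _) = padding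
  tracePhase (just a) t       = counted (t ⊓ toℕ a)

  <L'⇒<s' : ∀ {c t} → c ≤ suc t → suc t ≤ L' → c < s'
  <L'⇒<s' c≤ ≤L' = ≤-<-trans (≤-trans c≤ ≤L') (∸-monoʳ-< (s≤s z≤n) (≤-trans (≤-trans (s≤s z≤n) ≤L') (m∸n≤m s' 1)))

  phase-counted : ∀ {t} (σ : Letter) → toℕ σ ≤ suc t → suc t ≤ L' → phase (suc t) σ ≡ counted (toℕ σ)
  phase-counted σ σ≤ ≤L' =
    cong (λ b → if b then padding else counted (toℕ σ)) (dec-false (toℕ σ ≟ s') (<⇒≢ (<L'⇒<s' σ≤ ≤L')))

  phase-hash : ∀ t → phase (suc t) hash ≡ padding
  phase-hash t = cong (λ b → if b then padding else counted (toℕ hash)) (dec-true (toℕ hash ≟ s') (Finₚ.toℕ-fromℕ s'))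

  toℕ-trace : ∀ a t → toℕ (trace (just a) t) ≡ t ⊓ toℕ a
  toℕ-trace a t = Finₚ.toℕ-fromℕ< _

  phase-trace : ∀ c t → t ≤ L' → phase t (trace c t) ≡ tracePhase c t
  phase-trace nothing  zero    _   = refl
  phase-trace nothing  (suc t) _   = phase-hash t
  phase-trace (just a) zero    _   = cong counted (toℕ-trace a 0)
  phase-trace (just a) (suc t) ≤L' =
    trans (phase-counted (trace (just a) (suc t)) (subst (_≤ suc t) (sym (toℕ-trace a (suc t))) (m⊓n≤m (suc t) (toℕ a))) ≤L')
          (cong counted (toℕ-trace a (suc t)))

  advance-trace : ∀ c t → advance t (tracePhase c t) (codewordAt bit c t) ≡ just (tracePhase c (suc t))
  advance-trace nothing  zero    = refl
  advance-trace nothing  (suc t) = refl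
  advance-trace (just a) t with t <? toℕ a
  ... | yes t<a = begin
    advance t (counted (t ⊓ toℕ a)) (just (bit a t))
      ≡⟨ cong₂ (λ c b → advance t (counted c) (just b)) (m≤n⇒m⊓n≡m (<⇒≤ t<a)) (dec-true (t <? toℕ a) t<a) ⟩
    advance t (counted t) (just true)
      ≡⟨ cong (λ b → if b then just (counted (suc t)) else nothing) (dec-true (t ≟ t) refl) ⟩
    just (counted (suc t))
      ≡⟨ cong (λ c → just (counted c)) (m≤n⇒m⊓n≡m t<a) ⟨
    just (counted (suc t ⊓ toℕ a)) ∎
    where open ≡-Reasoning
  ... | no  t≮a = begin
    advance t (counted (t ⊓ toℕ a)) (just (bit a t))
      ≡⟨ cong (λ b → advance t (counted (t ⊓ toℕ a)) (just b)) (dec-false (t <? toℕ a) t≮a) ⟩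
    just (counted (t ⊓ toℕ a))
      ≡⟨ cong (λ c → just (counted c)) (trans (m≥n⇒m⊓n≡n a≤t) (sym (m≥n⇒m⊓n≡n (m≤n⇒m≤1+n a≤t)))) ⟩
    just (counted (suc t ⊓ toℕ a)) ∎
    where
      open ≡-Reasoning
      a≤t = ≮⇒≥ t≮a

  step : ℕ → Letter → Maybe Bool → Maybe Letter
  step t σ x = advance t (phase t σ) x >>= toState

  finish : Letter → Maybe Bool → Maybe (Maybe Letter)
  finish σ x = advance L' (phase L' σ) x >>= toLetter

  toState-trace : ∀ c t → toState (tracePhase c (suc t)) ≡ just (trace c (suc t))
  toState-trace nothing  t = refl
  toState-trace (just a) t = toFin-toℕ _ (toℕ-trace a (suc t))

  toLetter-trace : ∀ c → toLetter (tracePhase c (suc L')) ≡ just c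
  toLetter-trace nothing  = refl
  toLetter-trace (just a) =
    cong (Maybe.map just) (toFin-toℕ a (sym (m≥n⇒m⊓n≡n (≤-trans (≤-pred (Finₚ.toℕ<n a)) (m≤n+m∸n s' 1)))))

  advance-phase-trace : ∀ c t → t ≤ L' → advance t (phase t (trace c t)) (codewordAt bit c t) ≡ just (tracePhase c (suc t))
  advance-phase-trace c t t≤L' =
    trans (cong (λ ph → advance t ph (codewordAt bit c t)) (phase-trace c t t≤L')) (advance-trace c t)

  trace-step : ∀ c t → t < L' → step t (trace c t) (codewordAt bit c t) ≡ just (trace c (suc t))
  trace-step c t t<L' = trans (cong (_>>= toState) (advance-phase-trace c t (<⇒≤ t<L'))) (toState-trace c t)

  trace-finish : ∀ c → finish (trace c L') (codewordAt bit c L') ≡ just c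
  trace-finish c = trans (cong (_>>= toLetter) (advance-phase-trace c L' ≤-refl)) (toLetter-trace c)

  Agrees : (ℕ → Maybe Bool) → ℕ → Phase → Set
  Agrees x t padding     = ∀ j → j < t → x j ≡ nothing
  Agrees x t (counted c) = c ≤ t × (∀ j → j < t → x j ≡ just (does (j <? c)))

  count-one⁻¹ : ∀ c t {ph} → advance t (counted c) (just true) ≡ just ph → c ≡ t × ph ≡ counted (suc t)
  count-one⁻¹ c t e with c≡ᵇt , refl ← if-nothing⁻¹ {b = does (c ≟ t)} e = dec-true⁻¹ (c ≟ t) c≡ᵇt , refl

  advance-sound : ∀ x t ph {ph'} → Agrees x t ph → advance t ph (x t) ≡ just ph' → Agrees x (suc t) ph'
  advance-sound x t ph agree adv with x t in xt
  advance-sound x t padding agree refl | nothing = λ j j<1+t → [ agree j , (λ { refl → xt }) ]′ (m<1+n⇒m<n∨m≡n j<1+t)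
  advance-sound x zero (counted c) agree refl | nothing = λ { zero _ → xt ; (suc j) (s≤s ()) }
  advance-sound x t (counted c) (c≤t , agree) adv | just true with refl , refl ← count-one⁻¹ c t adv = ≤-refl , λ j j<1+c →
    [ (λ j<c → trans (agree j j<c) (cong just (trans (dec-true (j <? c) j<c) (sym (dec-true (j <? suc c) (m<n⇒m<1+n j<c))))))
    , (λ { refl → trans xt (cong just (sym (dec-true (c <? suc c) ≤-refl))) }) ]′ (m<1+n⇒m<n∨m≡n j<1+c)
  advance-sound x t (counted c) (c≤t , agree) refl | just false = m≤n⇒m≤1+n c≤t , λ j j<1+t →
    [ agree j , (λ { refl → trans xt (cong just (sym (dec-false (t <? c) (≤⇒≯ c≤t)))) }) ]′ (m<1+n⇒m<n∨m≡n j<1+t)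

  toState-sound : ∀ x t ph {σ} → suc t ≤ L' → Agrees x (suc t) ph → toState ph ≡ just σ → Agrees x (suc t) (phase (suc t) σ)
  toState-sound x t padding     _   agree refl = subst (Agrees x (suc t)) (sym (phase-hash t)) agree
  toState-sound x t (counted c) {σ} ≤L' agree@(c≤ , _) e with refl ← toFin⁻¹ c e =
    subst (Agrees x (suc t)) (sym (phase-counted σ c≤ ≤L')) agree

  toLetter-sound : ∀ x ph {d} → Agrees x (suc L') ph → toLetter ph ≡ just d → ∀ j → j ≤ L' → x j ≡ codewordAt bit d j
  toLetter-sound x padding     agree       refl j j≤L' = agree j (s≤s j≤L')
  toLetter-sound x (counted c) (_ , agree) e    j j≤L' with toFin c in fc
  toLetter-sound x (counted c) (_ , agree) refl j j≤L' | just a =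
    subst (λ c' → x j ≡ just (does (j <? c'))) (sym (toFin⁻¹ c fc)) (agree j (s≤s j≤L'))

  agrees : ∀ x (σ : ℕ → Letter) → σ 0 ≡ Fin.zero → (∀ t → t < L' → step t (σ t) (x t) ≡ just (σ (suc t))) →
           ∀ t → t ≤ L' → Agrees x t (phase t (σ t))
  agrees x σ σ₀ steps zero    _   = subst (λ σ' → Agrees x 0 (phase 0 σ')) (sym σ₀) (z≤n , λ j ())
  agrees x σ σ₀ steps (suc t) ≤L' with ph , adv , st ← >>=-just⁻¹ (advance t (phase t (σ t)) (x t)) (steps t ≤L') =
    toState-sound x t ph ≤L' (advance-sound x t _ (agrees x σ σ₀ steps t (<⇒≤ ≤L')) adv) st

  decode-sound : ∀ x (σ : ℕ → Letter) {d} → σ 0 ≡ Fin.zero → (∀ t → t < L' → step t (σ t) (x t) ≡ just (σ (suc t))) →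
                 finish (σ L') (x L') ≡ just d → ∀ t → t ≤ L' → x t ≡ codewordAt bit d t
  decode-sound x σ σ₀ steps fin with ph , adv , decoded ← >>=-just⁻¹ (advance L' (phase L' (σ L')) (x L')) fin =
    toLetter-sound x ph (advance-sound x L' _ (agrees x σ σ₀ steps L' ≤-refl) adv) decoded

  thermometer : BlockDecoder Letter Bool L'
  thermometer = record
    { State        = Letter
    ; Valid        = λ _ → Unit
    ; codeword     = bit
    ; start        = Fin.zero
    ; step         = step
    ; finish       = finish
    ; trace        = trace
    ; trace-start  = λ { nothing → refl ; (just _) → refl }
    ; trace-step   = λ {c} _ → trace-step c
    ; trace-finish = λ {c} _ → trace-finish c
    ; decode-sound = λ x σ {d} σ₀ steps fin → MaybeAll.universal (λ _ → tt) d , decode-sound x σ σ₀ steps fin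
    }

-- Decoding tuples componentwise

allJust : Vec (Maybe X) a → Maybe (Vec X a)
allJust []             = just []
allJust (nothing ∷ _)  = nothing
allJust (just x ∷ ms)  = Maybe.map (x ∷_) (allJust ms)

allJust-complete : (ms : Vec (Maybe X) a) (xs : Vec X a) → (∀ j → lookup ms j ≡ just (lookup xs j)) → allJust ms ≡ just xs
allJust-complete []       []       _ = refl
allJust-complete (m ∷ ms) (x ∷ xs) h with refl ← h Fin.zero = cong (Maybe.map (x ∷_)) (allJust-complete ms xs (λ j → h (Fin.suc j)))

allJust-sound : (ms : Vec (Maybe X) a) {xs : Vec X a} → allJust ms ≡ just xs → ∀ j → lookup ms j ≡ just (lookup xs j)
allJust-sound (just x ∷ ms) e j with allJust ms in e'
allJust-sound (just x ∷ ms) refl Fin.zero    | just xs = refl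
allJust-sound (just x ∷ ms) refl (Fin.suc j) | just xs = allJust-sound ms e' j

isPadding : Vec (Maybe X) a → Bool
isPadding []            = true
isPadding (nothing ∷ v) = isPadding v
isPadding (just _ ∷ _)  = false

isPadding-replicate : ∀ a → isPadding (replicate a (nothing {A = X})) ≡ true
isPadding-replicate zero    = refl
isPadding-replicate (suc a) = isPadding-replicate a

isPadding-map : (f : X → Y) (v : Vec (Maybe X) a) → isPadding (Vec.map (Maybe.map f) v) ≡ isPadding v
isPadding-map f []            = refl
isPadding-map f (nothing ∷ v) = isPadding-map f v
isPadding-map f (just _ ∷ v)  = refl

-- (#, …, #) never occurs in u₁ ⊗ ⋯ ⊗ u_a, so it is identified with the padding symbol of the
-- tensor alphabet.
collapse : Vec (Maybe X) a → Maybe (Vec (Maybe X) a)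
collapse v = if isPadding v then nothing else just v

spread : Maybe (Vec (Maybe X) a) → Vec (Maybe X) a
spread = fromMaybe (replicate _ nothing)

admissible : Maybe (Vec (Maybe X) a) → Bool
admissible nothing  = true
admissible (just v) = not (isPadding v)

collapse-spread : (x : Maybe (Vec (Maybe X) a)) → admissible x ≡ true → collapse (spread x) ≡ x
collapse-spread {a = a} nothing  _ = cong (λ b → if b then nothing else just (replicate a nothing)) (isPadding-replicate a)
collapse-spread (just v) e with isPadding v
collapse-spread (just v) () | true
... | false = refl

collapse-map : (f : X → Y) (v : Vec (Maybe X) a) → Maybe.map (Vec.map (Maybe.map f)) (collapse v) ≡ collapse (Vec.map (Maybe.map f) v)
collapse-map f v rewrite isPadding-map f v with isPadding v
... | true  = refl
... | false = refl

module TensorDecoding {A C : Set} {L' : ℕ} (R : BlockDecoder A C L') (a : ℕ) where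
  open BlockDecoder R

  Validᵀ : Tensor A a → Set
  Validᵀ cv = (∀ j → MaybeAll.All Valid (lookup cv j)) × isPadding cv ≡ false

  codewordᵀ : Tensor A a → ℕ → Tensor C a
  codewordᵀ cv t = Vec.map (λ d → codewordAt codeword d t) cv

  stepᵀ : ℕ → Vec State a → Maybe (Tensor C a) → Maybe (Vec State a)
  stepᵀ t σs x = if admissible x then allJust (Vec.zipWith (step t) σs (spread x)) else nothing

  finishᵀ : Vec State a → Maybe (Tensor C a) → Maybe (Maybe (Tensor A a))
  finishᵀ σs x = if admissible x then Maybe.map collapse (allJust (Vec.zipWith finish σs (spread x))) else nothing

  traceᵀ : Maybe (Tensor A a) → ℕ → Vec State a
  traceᵀ c t = Vec.map (λ d → trace d t) (spread c)

  spread-codewordAt : ∀ c t → spread (codewordAt codewordᵀ c t) ≡ Vec.map (λ d → codewordAt codeword d t) (spread c)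
  spread-codewordAt nothing  t = sym (Vecₚ.map-replicate (λ d → codewordAt codeword d t) nothing a)
  spread-codewordAt (just _) t = refl

  admissible-codewordAt : ∀ {c} → MaybeAll.All Validᵀ c → ∀ t → admissible (codewordAt codewordᵀ c t) ≡ true
  admissible-codewordAt MaybeAll.nothing               t = refl
  admissible-codewordAt (MaybeAll.just {cv} (_ , np))  t = cong not (trans (isPadding-map _ cv) np)

  admissible-letter : ∀ {c} → MaybeAll.All Validᵀ c → admissible c ≡ true
  admissible-letter MaybeAll.nothing          = refl
  admissible-letter (MaybeAll.just (_ , np))  = cong not np

  spread-valid : ∀ {c} → MaybeAll.All Validᵀ c → ∀ j → MaybeAll.All Valid (lookup (spread c) j)
  spread-valid MaybeAll.nothing         j = subst (MaybeAll.All Valid) (sym (Vecₚ.lookup-replicate j nothing)) MaybeAll.nothing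
  spread-valid (MaybeAll.just (vs , _)) j = vs j

  collapse-valid : (ds : Tensor A a) → (∀ j → MaybeAll.All Valid (lookup ds j)) → MaybeAll.All Validᵀ (collapse ds)
  collapse-valid ds vs with isPadding ds in np
  ... | true  = MaybeAll.nothing
  ... | false = MaybeAll.just (vs , np)

  lookup-spread-codewordAt : ∀ c t j → lookup (spread (codewordAt codewordᵀ c t)) j ≡ codewordAt codeword (lookup (spread c) j) t
  lookup-spread-codewordAt c t j = trans (cong (λ v → lookup v j) (spread-codewordAt c t)) (Vecₚ.lookup-map j _ (spread c))

  trace-stepᵀ : ∀ {c} → MaybeAll.All Validᵀ c → ∀ t → t < L' →
                stepᵀ t (traceᵀ c t) (codewordAt codewordᵀ c t) ≡ just (traceᵀ c (suc t))
  trace-stepᵀ {c} valid t t<L' =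
    trans (cong (λ b → if b then allJust steps else nothing) (admissible-codewordAt valid t))
          (allJust-complete steps (traceᵀ c (suc t)) component)
    where
    steps = Vec.zipWith (step t) (traceᵀ c t) (spread (codewordAt codewordᵀ c t))
    component : ∀ j → lookup steps j ≡ just (lookup (traceᵀ c (suc t)) j)
    component j = begin
      lookup steps j
        ≡⟨ Vecₚ.lookup-zipWith (step t) j (traceᵀ c t) (spread (codewordAt codewordᵀ c t)) ⟩
      step t (lookup (traceᵀ c t) j) (lookup (spread (codewordAt codewordᵀ c t)) j)
        ≡⟨ cong₂ (step t) (Vecₚ.lookup-map j _ (spread c)) (lookup-spread-codewordAt c t j) ⟩
      step t (trace d t) (codewordAt codeword d t)
        ≡⟨ trace-step (spread-valid valid j) t t<L' ⟩
      just (trace d (suc t))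
        ≡⟨ cong just (Vecₚ.lookup-map j _ (spread c)) ⟨
      just (lookup (traceᵀ c (suc t)) j) ∎
      where
        open ≡-Reasoning
        d = lookup (spread c) j

  trace-finishᵀ : ∀ {c} → MaybeAll.All Validᵀ c → finishᵀ (traceᵀ c L') (codewordAt codewordᵀ c L') ≡ just c
  trace-finishᵀ {c} valid =
    trans (cong (λ b → if b then Maybe.map collapse (allJust finishes) else nothing) (admissible-codewordAt valid L'))
          (trans (cong (Maybe.map collapse) (allJust-complete finishes (spread c) component))
                 (cong just (collapse-spread c (admissible-letter valid))))
    where
    finishes = Vec.zipWith finish (traceᵀ c L') (spread (codewordAt codewordᵀ c L'))
    component : ∀ j → lookup finishes j ≡ just (lookup (spread c) j)
    component j = begin
      lookup finishes j
        ≡⟨ Vecₚ.lookup-zipWith finish j (traceᵀ c L') (spread (codewordAt codewordᵀ c L')) ⟩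
      finish (lookup (traceᵀ c L') j) (lookup (spread (codewordAt codewordᵀ c L')) j)
        ≡⟨ cong₂ finish (Vecₚ.lookup-map j _ (spread c)) (lookup-spread-codewordAt c L' j) ⟩
      finish (trace d L') (codewordAt codeword d L')
        ≡⟨ trace-finish (spread-valid valid j) ⟩
      just d ∎
      where
        open ≡-Reasoning
        d = lookup (spread c) j

  decode-soundᵀ : ∀ (x : ℕ → Maybe (Tensor C a)) (σs : ℕ → Vec State a) {c} → σs 0 ≡ replicate a start →
                  (∀ t → t < L' → stepᵀ t (σs t) (x t) ≡ just (σs (suc t))) → finishᵀ (σs L') (x L') ≡ just c →
                  MaybeAll.All Validᵀ c × (∀ t → t ≤ L' → x t ≡ codewordAt codewordᵀ c t)
  decode-soundᵀ x σs {c} σ₀ steps fin =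
    subst (λ c' → MaybeAll.All Validᵀ c' × (∀ t → t ≤ L' → x t ≡ codewordAt codewordᵀ c' t)) collapse≡c
      (collapse-valid ds (λ j → proj₁ (component j)) , agree)
    where
    stepped : ∀ t → t < L' → admissible (x t) ≡ true × allJust (Vec.zipWith (step t) (σs t) (spread (x t))) ≡ just (σs (suc t))
    stepped t t<L' = if-nothing⁻¹ {b = admissible (x t)} (steps t t<L')

    finished = if-nothing⁻¹ {b = admissible (x L')} fin
    decoded = map-just⁻¹ (allJust (Vec.zipWith finish (σs L') (spread (x L')))) (proj₂ finished)
    ds = proj₁ decoded
    collapse≡c = proj₂ (proj₂ decoded)

    admissible-at : ∀ t → t ≤ L' → admissible (x t) ≡ true
    admissible-at t t≤L' with m≤n⇒m<n∨m≡n t≤L'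
    ... | inj₁ t<L' = proj₁ (stepped t t<L')
    ... | inj₂ refl = proj₁ finished

    component : ∀ j → MaybeAll.All Valid (lookup ds j) ×
                      (∀ t → t ≤ L' → lookup (spread (x t)) j ≡ codewordAt codeword (lookup ds j) t)
    component j = decode-sound (λ t → lookup (spread (x t)) j) (λ t → lookup (σs t) j)
      (trans (cong (λ v → lookup v j) σ₀) (Vecₚ.lookup-replicate j start))
      (λ t t<L' → trans (sym (Vecₚ.lookup-zipWith (step t) j (σs t) (spread (x t))))
                        (allJust-sound (Vec.zipWith (step t) (σs t) (spread (x t))) (proj₂ (stepped t t<L')) j))
      (trans (sym (Vecₚ.lookup-zipWith finish j (σs L') (spread (x L'))))
             (allJust-sound (Vec.zipWith finish (σs L') (spread (x L'))) (proj₁ (proj₂ decoded)) j))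

    agree : ∀ t → t ≤ L' → x t ≡ codewordAt codewordᵀ (collapse ds) t
    agree t t≤L' = begin
      x t
        ≡⟨ collapse-spread (x t) (admissible-at t t≤L') ⟨
      collapse (spread (x t))
        ≡⟨ cong collapse (lookup-ext λ j → trans (proj₂ (component j) t t≤L') (sym (Vecₚ.lookup-map j _ ds))) ⟩
      collapse (codewordᵀ ds t)
        ≡⟨ collapse-map (λ b → codeword b t) ds ⟨
      codewordAt codewordᵀ (collapse ds) t ∎
      where open ≡-Reasoning

  tensorDecoder : BlockDecoder (Tensor A a) (Tensor C a) L'
  tensorDecoder = record
    { State        = Vec State a
    ; Valid        = Validᵀ
    ; codeword     = codewordᵀ
    ; start        = replicate a start
    ; step         = stepᵀ
    ; finish       = finishᵀ
    ; trace        = traceᵀ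
    ; trace-start  = λ c → lookup-ext λ j →
        trans (Vecₚ.lookup-map j _ (spread c)) (trans (trace-start _) (sym (Vecₚ.lookup-replicate j start)))
    ; trace-step   = trace-stepᵀ
    ; trace-finish = trace-finishᵀ
    ; decode-sound = decode-soundᵀ
    }

column : Vec (List A) a → ℕ → Tensor A a
column us j = Vec.map (λ u → symAt u j) us

symAt-tensor : (us : Vec (List A) a) {j : ℕ} → j < maxLen us → symAt (tensor us) j ≡ just (column us j)
symAt-tensor us = symAt-applyUpTo _ (maxLen us)

symAt-tensor-≥ : (us : Vec (List A) a) {j : ℕ} → maxLen us ≤ j → symAt (tensor us) j ≡ nothing
symAt-tensor-≥ us = symAt-applyUpTo-≥ _ (maxLen us)

isPadding-column : (us : Vec (List A) a) {j : ℕ} → j < maxLen us → isPadding (column us j) ≡ false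
isPadding-column (u ∷ us) {j} j<max with symAt u j in uj
... | just _  = refl
... | nothing with j <? maxLen us
...   | yes j<max' = isPadding-column us j<max'
...   | no  j≮max' = contradiction (⊔-lub (symAt-nothing⇒length≤ u j uj) (≮⇒≥ j≮max')) (<⇒≱ j<max)

module TensorEncoding {C : Set} {L' : ℕ} (R : BlockDecoder A C L') where
  open BlockDecoder R
  open Encoding R
  open Blocks L'
  open TensorDecoding R
  module Encodingᵀ (a : ℕ) = Encoding (tensorDecoder a)

  tensor-valid : ∀ {a} (us : Vec (List A) a) → (∀ j → All Valid (lookup us j)) → All (Validᵀ a) (tensor us)
  tensor-valid {a} us valid = All-symAt (tensor us) λ n {cv} e → valid-column n cv e
    where
    valid-column : ∀ n cv → symAt (tensor us) n ≡ just cv → Validᵀ a cv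
    valid-column n cv e with n <? maxLen us
    ... | yes n<max with refl ← trans (sym (symAt-tensor us n<max)) e =
      (λ j → subst (MaybeAll.All Valid) (sym (Vecₚ.lookup-map j _ us)) (symAt-All (valid j) n)) , isPadding-column us n<max
    ... | no  n≮max with () ← trans (sym (symAt-tensor-≥ us (≮⇒≥ n≮max))) e

  maxLen-encode : (us : Vec (List A) a) → maxLen (Vec.map encode us) ≡ maxLen us * L
  maxLen-encode []       = refl
  maxLen-encode (u ∷ us) = trans (cong₂ _⊔_ (length-encode u) (maxLen-encode us)) (sym (*-distribʳ-⊔ L (length u) (maxLen us)))

  tensor-encode : (us : Vec (List A) a) → tensor (Vec.map encode us) ≡ Encodingᵀ.encode a (tensor us)
  tensor-encode {a = a} us = blockwise-ext λ i t t<L → trans (column-block i t<L) (sym (Encodingᵀ.symAt-encode a (tensor us) i t<L))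
    where
    column-block : ∀ i {t} → t < L → symAt (tensor (Vec.map encode us)) (i * L + t) ≡ codewordAt (codewordᵀ a) (symAt (tensor us) i) t
    column-block i {t} t<L with i <? maxLen us
    ... | yes i<max = begin
      symAt (tensor (Vec.map encode us)) (i * L + t)
        ≡⟨ symAt-tensor (Vec.map encode us) (subst (i * L + t <_) (sym (maxLen-encode us)) in-range) ⟩
      just (column (Vec.map encode us) (i * L + t))
        ≡⟨ cong just (trans (sym (Vecₚ.map-∘ _ encode us)) (trans (Vecₚ.map-cong (λ u → symAt-encode u i t<L) us) (Vecₚ.map-∘ _ _ us))) ⟩
      just (codewordᵀ a (column us i) t)
        ≡⟨ cong (λ c → codewordAt (codewordᵀ a) c t) (symAt-tensor us i<max) ⟨
      codewordAt (codewordᵀ a) (symAt (tensor us) i) t ∎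
      where
        open ≡-Reasoning
        in-range : i * L + t < maxLen us * L
        in-range = ≤-trans (s≤s (≤-trans (+-monoʳ-≤ (i * L) (≤-pred t<L)) (≤-reflexive (+-comm (i * L) L')))) (*-monoˡ-≤ L i<max)
    ... | no  i≮max = trans (symAt-tensor-≥ (Vec.map encode us) out-of-range)
                            (cong (λ c → codewordAt (codewordᵀ a) c t) (sym (symAt-tensor-≥ us (≮⇒≥ i≮max))))
      where
        out-of-range : maxLen (Vec.map encode us) ≤ i * L + t
        out-of-range = ≤-trans (≤-reflexive (maxLen-encode us)) (≤-trans (*-monoˡ-≤ L (≮⇒≥ i≮max)) (m≤m+n (i * L) t))

≤-foldr-⊔ : ∀ {m n} (g : Fin m → ℕ) (f : Fin n → Fin m) j → g (f j) ≤ foldr (λ i acc → g i ⊔ acc) 1 (List.tabulate f)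
≤-foldr-⊔ g f Fin.zero    = m≤m⊔n _ _
≤-foldr-⊔ g f (Fin.suc j) = ≤-trans (≤-foldr-⊔ g (f ∘ Fin.suc) j) (m≤n⊔m _ _)

1≤foldr-⊔ : ∀ {m n} (g : Fin m → ℕ) (f : Fin n → Fin m) → 1 ≤ foldr (λ i acc → g i ⊔ acc) 1 (List.tabulate f)
1≤foldr-⊔ {n = zero}  g f = ≤-refl
1≤foldr-⊔ {n = suc n} g f = ≤-trans (1≤foldr-⊔ g (f ∘ Fin.suc)) (m≤n⊔m _ _)

arity≤maxArity : ∀ m (ar : Fin m → ℕ) i → ar i ≤ maxArity m ar
arity≤maxArity m ar = ≤-foldr-⊔ ar (λ i → i)

1≤maxArity : ∀ m (ar : Fin m → ℕ) → 1 ≤ maxArity m ar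
1≤maxArity m ar = 1≤foldr-⊔ ar (λ i → i)

module Binarization {m : ℕ} {ar : Fin m → ℕ} (s' : ℕ) {w k : ℕ} (D₀ : ODD (Fin (suc s')) w k)
                    (D : (i : Fin m) → ODD (Tensor (Fin (suc s')) (ar i)) w k) where
  open Thermometer s'
  open TensorEncoding thermometer
  open TensorDecoding thermometer using (tensorDecoder)
  open Encoding thermometer

  N : ℕ
  N = suc s' ^ maxArity m ar

  letterCode : Letter ↪ Fin N
  letterCode = ↪-widen (↪-id Letter) s≤N Fin.zero
    where s≤N = ≤-trans (≤-reflexive (sym (*-identityʳ (suc s')))) (^-monoʳ-≤ (suc s') (1≤maxArity m ar))

  tupleCode : ∀ i → Vec Letter (ar i) ↪ Fin N
  tupleCode i = ↪-widen Vec↪Fin^ (^-monoʳ-≤ (suc s') (arity≤maxArity m ar i)) (Vec.replicate _ Fin.zero)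

  module E₀ = Expansion thermometer letterCode D₀
  module Eᵢ (i : Fin m) = Expansion (tensorDecoder (ar i)) (tupleCode i) (D i)

  all-valid : ∀ {v : List Letter} → All (λ _ → Unit) v
  all-valid {v} = universal (λ _ → tt) v

  expanded-⊆-tensor : (∀ i v → Accepts (D i) v → Σ[ us ∈ Vec (List Letter) (ar i) ] ((∀ j → Accepts D₀ (lookup us j)) × tensor us ≡ v)) →
    ∀ i v → Accepts (Eᵢ.expanded i) v → Σ[ us ∈ Vec (List Bool) (ar i) ] ((∀ j → Accepts E₀.expanded (lookup us j)) × tensor us ≡ v)
  expanded-⊆-tensor D⊆D₀⊗ i v acc
    with v₀ , v≡ , _ , acc₀ ← Eᵢ.expand-sound i acc
    with us , us∈ , us≡v₀ ← D⊆D₀⊗ i v₀ acc₀ =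
    Vec.map encode us ,
    (λ j → subst (Accepts E₀.expanded) (sym (Vecₚ.lookup-map j encode us)) (E₀.expand-complete all-valid (us∈ j))) ,
    trans (tensor-encode us) (trans (cong (Encodingᵀ.encode (ar i)) us≡v₀) (sym v≡))

  expanded-domain : ∀ {X : Set} (f : X → List Letter) → (∀ u → Accepts D₀ u ⇔ (∃[ x ] f x ≡ u)) →
                    ∀ u → Accepts E₀.expanded u ⇔ (∃[ x ] encode (f x) ≡ u)
  expanded-domain f dom u = mk⇔ to from
    where
    to : Accepts E₀.expanded u → ∃[ x ] encode (f x) ≡ u
    to acc with v , u≡ , _ , acc₀ ← E₀.expand-sound acc with x , fx≡v ← Equivalence.to (dom v) acc₀ =
      x , trans (cong encode fx≡v) (sym u≡)
    from : ∃[ x ] encode (f x) ≡ u → Accepts E₀.expanded u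
    from (x , refl) = E₀.expand-complete all-valid (Equivalence.from (dom (f x)) (x , refl))

  expanded-relations : (S : Structure m ar) (f : Fin (n S) → List Letter) →
    (∀ i xs → Rel S i xs ⇔ Accepts (D i) (tensor (Vec.map f xs))) →
    ∀ i xs → Rel S i xs ⇔ Accepts (Eᵢ.expanded i) (tensor (Vec.map (encode ∘ f) xs))
  expanded-relations S f rel i xs = mk⇔
    (λ r → subst (Accepts (Eᵢ.expanded i)) (sym tensor≡) (Eᵢ.expand-complete i valid (Equivalence.to (rel i xs) r)))
    (λ acc → Equivalence.from (rel i xs) (Eᵢ.expand-reflects i valid (subst (Accepts (Eᵢ.expanded i)) tensor≡ acc)))
    where
    tensor≡ : tensor (Vec.map (encode ∘ f) xs) ≡ Encodingᵀ.encode (ar i) (tensor (Vec.map f xs))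
    tensor≡ = trans (cong tensor (Vecₚ.map-∘ encode f xs)) (tensor-encode (Vec.map f xs))
    valid = tensor-valid (Vec.map f xs) (λ _ → all-valid)

decisional⇒binary : ∀ {m ar} (S : Structure m ar) s' w → Decisional (Fin (suc s')) w S →
                    Decisional Bool (w * suc s' ^ maxArity m ar) S
decisional⇒binary S s' w (k , 1≤k , D₀ , D , D⊆D₀⊗ , f , f-injective , dom , rel) =
  k * L , *-mono-≤ 1≤k (s≤s z≤n) , E₀.expanded , Eᵢ.expanded , expanded-⊆-tensor D⊆D₀⊗ ,
  encode ∘ f , f-injective ∘ encode-injective all-valid all-valid ,
  expanded-domain f dom , expanded-relations S f rel
  where
  open Binarization s' D₀ D
  open Blocks (Thermometer.L' s')
  open Encoding (Thermometer.thermometer s')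

proposition2 : (m : ℕ) (ar : Fin m → ℕ) (s : ℕ) (w : ℕ) → 1 ≤ s → 1 ≤ w →
    (S : Structure m ar) → DwLe (Fin s) S w →
    DwLe Bool S ((w ^ 2) * (s ^ maxArity m ar))
proposition2 m ar (suc s') (suc w₀) _ _ S (w' , 1≤w' , w'≤w , decisional) =
  w' * N , *-mono-≤ 1≤w' (m^n>0 (suc s') (maxArity m ar)) ,
  *-monoˡ-≤ N (≤-trans w'≤w (m≤m*n (suc w₀) (suc w₀ * 1))) ,
  decisional⇒binary S s' w' decisional
  where N = suc s' ^ maxArity m ar
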